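{- Let $i$ be a vertex in a quiver $Q$ with large weights. Suppose that $Q$ has a global descent at a vertex different from $i$, and that $Q$ is vortex-free. Then: (A) $i$ is an ascent in every cyclic 3-vertex full subquiver of $Q$ that contains it; (B) $i$ is not a sink or source in $Q$; (C) $i$ is not the apex of a vortex in $Q$.
   Context: Quivers are finite directed multigraphs without loops or oriented 2-cycles, encoded by skew-symmetric $B(Q)=(b_{ij})$; mutation at $k$: $b'_{ij}=-b_{ij}$ if $k\in\{i,j\}$, else $b'_{ij}=b_{ij}+\tfrac12(|b_{ik}|b_{kj}+b_{ik}|b_{kj}|)$. Large weights: $|b_{uv}|\ge 2$ for all $u\ne v$. Write $u\dashrightarrow v$ if $b_{uv}\ge 0$; a sink (source) is a vertex $i$ with $v\dashrightarrow i$ ($i\dashrightarrow v$) for all other $v$. Full subquiver = induced subgraph. A 3-vertex quiver is cyclic if it contains an oriented 3-cycle. In a 3-vertex quiver on $\{i,j,k\}$, $i$ is an ascent (descent) if $|b_{jk}(\mu[i](Q))|>|b_{jk}(Q)|$ (resp. $<$). $Q$ has a global descent at $v$ if $Q$ contains at least one cyclic 3-vertex full subquiver and every such subquiver has descent at $v$. A vortex is a 4-vertex quiver with all weights nonzero, one vertex (the apex) a sink or source, and the remaining three supporting a cyclic 3-vertex subquiver; $Q$ is vortex-free if none of its full 4-vertex subquivers is a vortex. -}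

module Defs where

open import Data.Nat using (ℕ)
open import Data.Integer using (ℤ; +_; -_; _+_; _*_; ∣_∣; _<_; _≤_; 0ℤ)
open import Data.Integer.DivMod using (_/ℕ_)
open import Data.Fin using (Fin)
open import Data.Product using (_×_; Σ)
open import Data.Sum using (_⊎_)
open import Relation.Nullary using (¬_)
open import Relation.Binary.PropositionalEquality using (_≡_; _≢_)

-- A quiver on vertex set Fin n, encoded by its skew-symmetric exchange matrix B(Q).
-- (No loops: b_ii = 0 follows from skew-symmetry; no 2-cycles is built into the encoding.)
record Quiver (n : ℕ) : Set where
  field
    b    : Fin n → Fin n → ℤ
    skew : ∀ i j → b i j ≡ - b j i
open Quiver public

abs : ℤ → ℤ
abs x = + ∣ x ∣

-- Matrix mutation at k:
--   b'_ij = -b_ij if k ∈ {i,j}, else b_ij + (|b_ik| b_kj + b_ik |b_kj|)/2.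
-- We only need the entries with i,j,k pairwise distinct (the "else" case).
mutEntry : ∀ {n} → Quiver n → (k i j : Fin n) → ℤ
mutEntry Q k i j =
  b Q i j + ((abs (b Q i k) * b Q k j + b Q i k * abs (b Q k j)) /ℕ 2)

LargeWeights : ∀ {n} → Quiver n → Set
LargeWeights Q = ∀ u v → u ≢ v → + 2 ≤ abs (b Q u v)

_⊢_⇢_ : ∀ {n} → Quiver n → Fin n → Fin n → Set
Q ⊢ u ⇢ v = 0ℤ ≤ b Q u v

IsSink : ∀ {n} → Quiver n → Fin n → Set
IsSink Q i = ∀ v → v ≢ i → Q ⊢ v ⇢ i

IsSource : ∀ {n} → Quiver n → Fin n → Set
IsSource Q i = ∀ v → v ≢ i → Q ⊢ i ⇢ v

Distinct3 : ∀ {n} → Fin n → Fin n → Fin n → Set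
Distinct3 a b c = a ≢ b × a ≢ c × b ≢ c

-- The full subquiver on {a,b,c} contains an oriented 3-cycle (an arrow u → v means b_uv > 0).
Cyclic3 : ∀ {n} → Quiver n → Fin n → Fin n → Fin n → Set
Cyclic3 Q a c d =
  (0ℤ < b Q a c × 0ℤ < b Q c d × 0ℤ < b Q d a)
  ⊎ (0ℤ < b Q a d × 0ℤ < b Q d c × 0ℤ < b Q c a)

-- In the 3-vertex subquiver on {i,j,k}: i is an ascent / descent.
-- (b_jk(μ_i(Q)) depends only on the entries among i,j,k, so mutating Q or the subquiver agrees.)
Ascent : ∀ {n} → Quiver n → (i j k : Fin n) → Set
Ascent Q i j k = abs (b Q j k) < abs (mutEntry Q i j k)

Descent : ∀ {n} → Quiver n → (i j k : Fin n) → Set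
Descent Q i j k = abs (mutEntry Q i j k) < abs (b Q j k)

HasDescentAt : ∀ {n} → Quiver n → (v a c d : Fin n) → Set
HasDescentAt Q v a c d =
  (v ≡ a × Descent Q a c d) ⊎ (v ≡ c × Descent Q c a d) ⊎ (v ≡ d × Descent Q d a c)

GlobalDescent : ∀ {n} → Quiver n → Fin n → Set
GlobalDescent Q v =
  Σ (Fin _) (λ a → Σ (Fin _) (λ c → Σ (Fin _) (λ d → Distinct3 a c d × Cyclic3 Q a c d)))
  × (∀ a c d → Distinct3 a c d → Cyclic3 Q a c d → HasDescentAt Q v a c d)

VortexWithApex : ∀ {n} → Quiver n → (a c d e : Fin n) → Set
VortexWithApex Q a c d e =
  (a ≢ c × a ≢ d × a ≢ e × Distinct3 c d e)
  × (b Q a c ≢ 0ℤ × b Q a d ≢ 0ℤ × b Q a e ≢ 0ℤ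
     × b Q c d ≢ 0ℤ × b Q c e ≢ 0ℤ × b Q d e ≢ 0ℤ)
  × ((Q ⊢ c ⇢ a × Q ⊢ d ⇢ a × Q ⊢ e ⇢ a)
     ⊎ (Q ⊢ a ⇢ c × Q ⊢ a ⇢ d × Q ⊢ a ⇢ e))
  × Cyclic3 Q c d e

VortexFree : ∀ {n} → Quiver n → Set
VortexFree Q = ∀ a c d e → ¬ VortexWithApex Q a c d e

-- Write P, R, S for the weights of the edges ij, jk, ki of a cyclic triangle. Mutating a cyclic
-- triangle at a vertex replaces the weight of the opposite edge by the absolute difference of
-- that weight and the product of the other two. The global descent at v ≠ i puts a descent at j
-- or k; at j it reads |S - PR| < S, i.e. PR < 2S, and with P ≥ 2 this gives 2PR < 4S ≤ P²S, so
-- 2R < PS and |R - PS| > R: i is an ascent (symmetrically for a descent at k, using S ≥ 2).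
-- A sink or source cannot lie on a cyclic triangle, so together with any cyclic triangle it
-- spans a vortex of which it is the apex.
module Submission where

open import Defs
open import Data.Nat using (ℕ)
open import Data.Fin using (Fin)
open import Data.Product using (_×_; Σ)
open import Relation.Nullary using (¬_)
open import Relation.Binary.PropositionalEquality using (_≢_)

open import Data.Product using (_,_)
open import Data.Sum using (_⊎_; inj₁; inj₂; [_,_]′)
open import Data.Empty using (⊥-elim)
open import Function using (_∘_)
open import Relation.Binary.PropositionalEquality
  using (_≡_; refl; sym; trans; cong; subst; ≢-sym; module ≡-Reasoning)

module _ where
  open import Data.Nat
  open import Data.Nat.Properties
  open import Data.Nat.Tactic.RingSolver using (solve-∀)

  ∣s-pr∣<s⇒r<∣r-ps∣ : ∀ {p r s} → 2 ≤ p → ∣ s - p * r ∣ < s → r < ∣ r - p * s ∣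
  ∣s-pr∣<s⇒r<∣r-ps∣ {p} {r} {s} 2≤p ∣s-pr∣<s =
    subst (r <_) (sym (m≤n⇒∣m-n∣≡n∸m (≤-trans (m≤m+n r r) (<⇒≤ 2r<ps))))
          (m+n≤o⇒m≤o∸n (suc r) 2r<ps)
    where
    pr<2s : p * r < s + s
    pr<2s = begin-strict
      p * r              ≤⟨ m≤∣m-n∣+n (p * r) s ⟩
      ∣ p * r - s ∣ + s  ≡⟨ cong (_+ s) (∣-∣-comm (p * r) s) ⟩
      ∣ s - p * r ∣ + s  <⟨ +-monoˡ-< s ∣s-pr∣<s ⟩
      s + s              ∎
      where open ≤-Reasoning

    [s+s]+[s+s]≡[2*2]*s : ∀ s → (s + s) + (s + s) ≡ (2 * 2) * s
    [s+s]+[s+s]≡[2*2]*s = solve-∀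

    2r<ps : r + r < p * s
    2r<ps = *-cancelˡ-< p (r + r) (p * s) (begin-strict
      p * (r + r)              ≡⟨ *-distribˡ-+ p r r ⟩
      p * r + p * r            <⟨ +-mono-< pr<2s pr<2s ⟩
      (s + s) + (s + s)        ≡⟨ [s+s]+[s+s]≡[2*2]*s s ⟩
      (2 * 2) * s              ≤⟨ *-monoˡ-≤ s (*-mono-≤ 2≤p 2≤p) ⟩
      (p * p) * s              ≡⟨ *-assoc p p s ⟩
      p * (p * s)              ∎)
      where open ≤-Reasoning

import Data.Nat as ℕ
import Data.Nat.Properties as ℕ
open import Data.Nat.DivMod using (m*n/n≡m; m*n%n≡0)
open import Data.Integer
  using (ℤ; +_; -[1+_]; +[1+_]; -_; _+_; _*_; ∣_∣; 0ℤ; _/ℕ_; _⊖_; _<_; +<+; -<+)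
open import Data.Integer.Properties
  using (∣⊖∣-≤; ∣m⊖n∣≡∣n⊖m∣; ∣-i∣≡∣i∣; m-n≡m⊖n; -m+n≡n⊖m; pos-*; neg-distribˡ-*;
         neg-mono-<; neg-involutive; <⇒≱; drop‿+<+; drop‿+≤+)

SameSign : ℤ → ℤ → Set
SameSign i j = (0ℤ < i × 0ℤ < j) ⊎ (i < 0ℤ × j < 0ℤ)

OppositeSign : ℤ → ℤ → Set
OppositeSign i j = (0ℤ < i × j < 0ℤ) ⊎ (i < 0ℤ × 0ℤ < j)

m+m≡m*2 : ∀ m → m ℕ.+ m ≡ m ℕ.* 2
m+m≡m*2 m = trans (cong (m ℕ.+_) (sym (ℕ.+-identityʳ m))) (ℕ.*-comm 2 m)

[1+n]%d≡0⇒-[1+n]/ℕd≡-[[1+n]/d] : ∀ n d .{{_ : ℕ.NonZero d}} →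
  ℕ.suc n ℕ.% d ≡ 0 → -[1+ n ] /ℕ d ≡ - + (ℕ.suc n ℕ./ d)
[1+n]%d≡0⇒-[1+n]/ℕd≡-[[1+n]/d] n d eq with ℕ.suc n ℕ.% d | eq
... | .0 | refl = refl

[i+i]/ℕ2≡i : ∀ i → (i + i) /ℕ 2 ≡ i
[i+i]/ℕ2≡i (+ m) = cong +_ (trans (cong (ℕ._/ 2) (m+m≡m*2 m)) (m*n/n≡m m 2))
[i+i]/ℕ2≡i -[1+ m ] = begin
  -[1+ ℕ.suc (m ℕ.+ m) ] /ℕ 2
    ≡⟨ [1+n]%d≡0⇒-[1+n]/ℕd≡-[[1+n]/d] (ℕ.suc (m ℕ.+ m)) 2 even ⟩
  - + (ℕ.suc (ℕ.suc (m ℕ.+ m)) ℕ./ 2) ≡⟨ cong (λ n → - + (n ℕ./ 2)) 2+2m≡[1+m]*2 ⟩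
  - + (ℕ.suc m ℕ.* 2 ℕ./ 2)           ≡⟨ cong (-_ ∘ +_) (m*n/n≡m (ℕ.suc m) 2) ⟩
  -[1+ m ]                            ∎
  where
  open ≡-Reasoning
  2+2m≡[1+m]*2 : ℕ.suc (ℕ.suc (m ℕ.+ m)) ≡ ℕ.suc m ℕ.* 2
  2+2m≡[1+m]*2 = trans (cong ℕ.suc (sym (ℕ.+-suc m m))) (m+m≡m*2 (ℕ.suc m))
  even : ℕ.suc (ℕ.suc (m ℕ.+ m)) ℕ.% 2 ≡ 0
  even = trans (cong (ℕ._% 2) 2+2m≡[1+m]*2) (m*n%n≡0 (ℕ.suc m) 2)

∣m⊖n∣≡∣m-n∣ : ∀ m n → ∣ m ⊖ n ∣ ≡ ℕ.∣ m - n ∣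
∣m⊖n∣≡∣m-n∣ m n with ℕ.≤-total m n
... | inj₁ m≤n = trans (∣⊖∣-≤ m≤n) (sym (ℕ.m≤n⇒∣m-n∣≡n∸m m≤n))
... | inj₂ n≤m = trans (∣m⊖n∣≡∣n⊖m∣ m n) (trans (∣⊖∣-≤ n≤m) (sym (ℕ.m≤n⇒∣n-m∣≡n∸m n≤m)))

∣i∣*j≡i*∣j∣ : ∀ {i j} → SameSign i j → abs i * j ≡ i * abs j
∣i∣*j≡i*∣j∣ (inj₁ (+<+ (ℕ.s≤s _) , +<+ (ℕ.s≤s _))) = refl
∣i∣*j≡i*∣j∣ (inj₂ (-<+ , -<+))                     = refl

∣i+j*∣k∣∣≡∣∣i∣-∣j∣*∣k∣∣ : ∀ {i j} k → OppositeSign i j →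
  ∣ i + j * abs k ∣ ≡ ℕ.∣ ∣ i ∣ - ∣ j ∣ ℕ.* ∣ k ∣ ∣
∣i+j*∣k∣∣≡∣∣i∣-∣j∣*∣k∣∣ k (inj₁ (+<+ {n = ℕ.suc r} _ , -<+ {p})) = begin
  ∣ +[1+ r ] + -[1+ p ] * + ∣ k ∣ ∣  ≡⟨ cong (λ x → ∣ +[1+ r ] + x ∣) -[1+p]*∣k∣≡-pk ⟩
  ∣ + ℕ.suc r + - + pk ∣             ≡⟨ cong ∣_∣ (m-n≡m⊖n (ℕ.suc r) pk) ⟩
  ∣ ℕ.suc r ⊖ pk ∣                   ≡⟨ ∣m⊖n∣≡∣m-n∣ (ℕ.suc r) pk ⟩
  ℕ.∣ ℕ.suc r - pk ∣                 ∎
  where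
  open ≡-Reasoning
  pk = ℕ.suc p ℕ.* ∣ k ∣
  -[1+p]*∣k∣≡-pk : -[1+ p ] * + ∣ k ∣ ≡ - + pk
  -[1+p]*∣k∣≡-pk =
    trans (sym (neg-distribˡ-* +[1+ p ] (+ ∣ k ∣))) (cong -_ (sym (pos-* (ℕ.suc p) ∣ k ∣)))
∣i+j*∣k∣∣≡∣∣i∣-∣j∣*∣k∣∣ k (inj₂ (-<+ {r} , +<+ {n = ℕ.suc p} _)) = begin
  ∣ -[1+ r ] + +[1+ p ] * + ∣ k ∣ ∣  ≡⟨ cong (λ x → ∣ -[1+ r ] + x ∣) (sym (pos-* (ℕ.suc p) ∣ k ∣)) ⟩
  ∣ -[1+ r ] + + pk ∣                ≡⟨ cong ∣_∣ (-m+n≡n⊖m (ℕ.suc r) pk) ⟩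
  ∣ pk ⊖ ℕ.suc r ∣                   ≡⟨ ∣m⊖n∣≡∣m-n∣ pk (ℕ.suc r) ⟩
  ℕ.∣ pk - ℕ.suc r ∣                 ≡⟨ ℕ.∣-∣-comm pk (ℕ.suc r) ⟩
  ℕ.∣ ℕ.suc r - pk ∣                 ∎
  where
  open ≡-Reasoning
  pk = ℕ.suc p ℕ.* ∣ k ∣

private variable
  n : ℕ

-bᵀ≡b : ∀ (Q : Quiver n) i j → - b Q j i ≡ b Q i j
-bᵀ≡b Q i j = trans (cong -_ (skew Q j i)) (neg-involutive (b Q i j))

∣b∣≡∣bᵀ∣ : ∀ (Q : Quiver n) i j → ∣ b Q i j ∣ ≡ ∣ b Q j i ∣
∣b∣≡∣bᵀ∣ Q i j = trans (cong ∣_∣ (skew Q i j)) (∣-i∣≡∣i∣ (b Q j i))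

0<b⇒bᵀ<0 : ∀ (Q : Quiver n) {i j} → 0ℤ < b Q i j → b Q j i < 0ℤ
0<b⇒bᵀ<0 Q {i} {j} 0<b = subst (_< 0ℤ) (-bᵀ≡b Q j i) (neg-mono-< 0<b)

mutEntry≡b+b*∣b∣ : ∀ (Q : Quiver n) k i j → SameSign (b Q i k) (b Q k j) →
  mutEntry Q k i j ≡ b Q i j + b Q i k * abs (b Q k j)
mutEntry≡b+b*∣b∣ Q k i j same = cong (λ x → b Q i j + x) (begin
  (abs (b Q i k) * b Q k j + b Q i k * abs (b Q k j)) /ℕ 2
    ≡⟨ cong (λ x → (x + b Q i k * abs (b Q k j)) /ℕ 2) (∣i∣*j≡i*∣j∣ same) ⟩
  (b Q i k * abs (b Q k j) + b Q i k * abs (b Q k j)) /ℕ 2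
    ≡⟨ [i+i]/ℕ2≡i (b Q i k * abs (b Q k j)) ⟩
  b Q i k * abs (b Q k j) ∎)
  where open ≡-Reasoning

weight≥2 : ∀ (Q : Quiver n) {u v} → LargeWeights Q → u ≢ v → 2 ℕ.≤ ∣ b Q u v ∣
weight≥2 Q large u≢v = drop‿+≤+ (large _ _ u≢v)

weight≢0 : ∀ (Q : Quiver n) {u v} → LargeWeights Q → u ≢ v → b Q u v ≢ 0ℤ
weight≢0 Q large u≢v b≡0 with subst (λ x → 2 ℕ.≤ ∣ x ∣) b≡0 (weight≥2 Q large u≢v)
... | ()

Distinct3-rotate : ∀ {a c d : Fin n} → Distinct3 a c d → Distinct3 c d a
Distinct3-rotate (a≢c , a≢d , c≢d) = c≢d , ≢-sym a≢c , ≢-sym a≢d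

Cyclic3-rotate : ∀ (Q : Quiver n) {a c d} → Cyclic3 Q a c d → Cyclic3 Q c d a
Cyclic3-rotate Q (inj₁ (ac , cd , da)) = inj₁ (cd , da , ac)
Cyclic3-rotate Q (inj₂ (ad , dc , ca)) = inj₂ (ca , ad , dc)

Cyclic3-swap : ∀ (Q : Quiver n) {a c d} → Cyclic3 Q a c d → Cyclic3 Q c a d
Cyclic3-swap Q (inj₁ (ac , cd , da)) = inj₂ (cd , da , ac)
Cyclic3-swap Q (inj₂ (ad , dc , ca)) = inj₁ (ca , ad , dc)

Cyclic3⇒out-arrow : ∀ (Q : Quiver n) {a c d} → Cyclic3 Q a c d → 0ℤ < b Q a c ⊎ 0ℤ < b Q a d
Cyclic3⇒out-arrow Q (inj₁ (ac , _ , _)) = inj₁ ac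
Cyclic3⇒out-arrow Q (inj₂ (ad , _ , _)) = inj₂ ad

Cyclic3⇒in-arrow : ∀ (Q : Quiver n) {a c d} → Cyclic3 Q a c d → 0ℤ < b Q c a ⊎ 0ℤ < b Q d a
Cyclic3⇒in-arrow Q (inj₁ (_ , _ , da)) = inj₂ da
Cyclic3⇒in-arrow Q (inj₂ (_ , _ , ca)) = inj₁ ca

Cyclic3⇒signs : ∀ (Q : Quiver n) {a c d} → Cyclic3 Q a c d →
  SameSign (b Q c a) (b Q a d) × OppositeSign (b Q c d) (b Q c a)
Cyclic3⇒signs Q (inj₁ (ac , cd , da)) =
  inj₂ (0<b⇒bᵀ<0 Q ac , 0<b⇒bᵀ<0 Q da) , inj₁ (cd , 0<b⇒bᵀ<0 Q ac)
Cyclic3⇒signs Q (inj₂ (ad , dc , ca)) =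
  inj₁ (ca , ad) , inj₂ (0<b⇒bᵀ<0 Q dc , ca)

∣mutEntry∣-cyclic : ∀ (Q : Quiver n) {a c d} → Cyclic3 Q a c d →
  ∣ mutEntry Q a c d ∣ ≡ ℕ.∣ ∣ b Q c d ∣ - ∣ b Q c a ∣ ℕ.* ∣ b Q a d ∣ ∣
∣mutEntry∣-cyclic Q {a} {c} {d} cyc with Cyclic3⇒signs Q cyc
... | same , opposite =
  trans (cong ∣_∣ (mutEntry≡b+b*∣b∣ Q a c d same)) (∣i+j*∣k∣∣≡∣∣i∣-∣j∣*∣k∣∣ (b Q a d) opposite)

cyclic-descent⇒ascent : ∀ (Q : Quiver n) {i j k} → LargeWeights Q → Distinct3 i j k →
  Cyclic3 Q i j k → Descent Q j i k ⊎ Descent Q k i j → Ascent Q i j k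
cyclic-descent⇒ascent Q {i} {j} {k} large (i≢j , i≢k , _) cyc descent =
  +<+ (subst (R ℕ.<_) (sym ∣μᵢbⱼₖ∣≡∣R-PS∣) (R<∣R-PS∣ descent))
  where
  P = ∣ b Q i j ∣
  R = ∣ b Q j k ∣
  S = ∣ b Q i k ∣

  ∣μᵢbⱼₖ∣≡∣R-PS∣ : ∣ mutEntry Q i j k ∣ ≡ ℕ.∣ R - P ℕ.* S ∣
  ∣μᵢbⱼₖ∣≡∣R-PS∣ = trans (∣mutEntry∣-cyclic Q cyc)
                         (cong (λ x → ℕ.∣ R - x ℕ.* S ∣) (∣b∣≡∣bᵀ∣ Q j i))

  ∣μⱼbᵢₖ∣≡∣S-PR∣ : ∣ mutEntry Q j i k ∣ ≡ ℕ.∣ S - P ℕ.* R ∣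
  ∣μⱼbᵢₖ∣≡∣S-PR∣ = ∣mutEntry∣-cyclic Q (Cyclic3-swap Q cyc)

  ∣μₖbᵢⱼ∣≡∣P-SR∣ : ∣ mutEntry Q k i j ∣ ≡ ℕ.∣ P - S ℕ.* R ∣
  ∣μₖbᵢⱼ∣≡∣P-SR∣ = trans (∣mutEntry∣-cyclic Q (Cyclic3-rotate Q (Cyclic3-rotate Q cyc)))
                         (cong (λ x → ℕ.∣ P - S ℕ.* x ∣) (∣b∣≡∣bᵀ∣ Q k j))

  R<∣R-PS∣ : Descent Q j i k ⊎ Descent Q k i j → R ℕ.< ℕ.∣ R - P ℕ.* S ∣
  R<∣R-PS∣ (inj₁ descent-at-j) = ∣s-pr∣<s⇒r<∣r-ps∣ (weight≥2 Q large i≢j)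
          (subst (ℕ._< S) ∣μⱼbᵢₖ∣≡∣S-PR∣ (drop‿+<+ descent-at-j))
  R<∣R-PS∣ (inj₂ descent-at-k) = subst (λ x → R ℕ.< ℕ.∣ R - x ∣) (ℕ.*-comm S P)
          (∣s-pr∣<s⇒r<∣r-ps∣ (weight≥2 Q large i≢k)
            (subst (ℕ._< P) ∣μₖbᵢⱼ∣≡∣P-SR∣ (drop‿+<+ descent-at-k)))

descent-avoiding : ∀ (Q : Quiver n) {v a c d} → v ≢ a →
  HasDescentAt Q v a c d → Descent Q c a d ⊎ Descent Q d a c
descent-avoiding Q v≢a (inj₁ (v≡a , _))       = ⊥-elim (v≢a v≡a)
descent-avoiding Q _   (inj₂ (inj₁ (_ , dc))) = inj₁ dc
descent-avoiding Q _   (inj₂ (inj₂ (_ , dd))) = inj₂ dd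

sink⇒no-out-arrow : ∀ (Q : Quiver n) {i w} → IsSink Q i → w ≢ i → ¬ 0ℤ < b Q i w
sink⇒no-out-arrow Q sink w≢i 0<b = <⇒≱ (0<b⇒bᵀ<0 Q 0<b) (sink _ w≢i)

source⇒no-in-arrow : ∀ (Q : Quiver n) {i w} → IsSource Q i → w ≢ i → ¬ 0ℤ < b Q w i
source⇒no-in-arrow Q source w≢i 0<b = <⇒≱ (0<b⇒bᵀ<0 Q 0<b) (source _ w≢i)

sink∉cyclic : ∀ (Q : Quiver n) {i a c d} → IsSink Q i →
  Distinct3 a c d → Cyclic3 Q a c d → i ≢ a
sink∉cyclic Q sink (a≢c , a≢d , _) cyc refl =
  [ sink⇒no-out-arrow Q sink (≢-sym a≢c) , sink⇒no-out-arrow Q sink (≢-sym a≢d) ]′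
    (Cyclic3⇒out-arrow Q cyc)

source∉cyclic : ∀ (Q : Quiver n) {i a c d} → IsSource Q i →
  Distinct3 a c d → Cyclic3 Q a c d → i ≢ a
source∉cyclic Q source (a≢c , a≢d , _) cyc refl =
  [ source⇒no-in-arrow Q source (≢-sym a≢c) , source⇒no-in-arrow Q source (≢-sym a≢d) ]′
    (Cyclic3⇒in-arrow Q cyc)

∉cyclic-rotations : ∀ (Q : Quiver n) {i} →
  (∀ {a c d} → Distinct3 a c d → Cyclic3 Q a c d → i ≢ a) →
  ∀ {a c d} → Distinct3 a c d → Cyclic3 Q a c d → i ≢ a × i ≢ c × i ≢ d
∉cyclic-rotations Q i∉first distinct cyc =
  i∉first distinct cyc ,
  i∉first (Distinct3-rotate distinct) (Cyclic3-rotate Q cyc) ,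
  i∉first (Distinct3-rotate (Distinct3-rotate distinct)) (Cyclic3-rotate Q (Cyclic3-rotate Q cyc))

vortex-over-cyclic : ∀ (Q : Quiver n) {i a c d} → LargeWeights Q →
  i ≢ a × i ≢ c × i ≢ d → Distinct3 a c d → Cyclic3 Q a c d →
  (Q ⊢ a ⇢ i × Q ⊢ c ⇢ i × Q ⊢ d ⇢ i) ⊎ (Q ⊢ i ⇢ a × Q ⊢ i ⇢ c × Q ⊢ i ⇢ d) →
  VortexWithApex Q i a c d
vortex-over-cyclic Q large (i≢a , i≢c , i≢d) distinct@(a≢c , a≢d , c≢d) cyc orientation =
  (i≢a , i≢c , i≢d , distinct) ,
  (nonzero i≢a , nonzero i≢c , nonzero i≢d , nonzero a≢c , nonzero a≢d , nonzero c≢d) ,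
  orientation ,
  cyc
  where
  nonzero : ∀ {u v} → u ≢ v → b Q u v ≢ 0ℤ
  nonzero = weight≢0 Q large

sink-apex : ∀ (Q : Quiver n) {i a c d} → LargeWeights Q → IsSink Q i →
  Distinct3 a c d → Cyclic3 Q a c d → VortexWithApex Q i a c d
sink-apex Q large sink distinct cyc
  with ∉cyclic-rotations Q (sink∉cyclic Q sink) distinct cyc
... | i∉@(i≢a , i≢c , i≢d) = vortex-over-cyclic Q large i∉ distinct cyc
  (inj₁ (sink _ (≢-sym i≢a) , sink _ (≢-sym i≢c) , sink _ (≢-sym i≢d)))

source-apex : ∀ (Q : Quiver n) {i a c d} → LargeWeights Q → IsSource Q i →
  Distinct3 a c d → Cyclic3 Q a c d → VortexWithApex Q i a c d
source-apex Q large source distinct cyc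
  with ∉cyclic-rotations Q (source∉cyclic Q source) distinct cyc
... | i∉@(i≢a , i≢c , i≢d) = vortex-over-cyclic Q large i∉ distinct cyc
  (inj₂ (source _ (≢-sym i≢a) , source _ (≢-sym i≢c) , source _ (≢-sym i≢d)))

lemma6p7 : {n : ℕ} (Q : Quiver n) (i : Fin n) →
    LargeWeights Q →
    Σ (Fin n) (λ v → v ≢ i × GlobalDescent Q v) →
    VortexFree Q →
    (∀ j k → Distinct3 i j k → Cyclic3 Q i j k → Ascent Q i j k)
    × ¬ IsSink Q i × ¬ IsSource Q i
    × (∀ c d e → ¬ VortexWithApex Q i c d e)
lemma6p7 Q i large (v , v≢i , (a , c , d , distinct , cyc) , descent) vortex-free =
  (λ j k ijk cyc-ijk →
    cyclic-descent⇒ascent Q large ijk cyc-ijk (descent-avoiding Q v≢i (descent i j k ijk cyc-ijk))) ,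
  (λ sink → vortex-free i a c d (sink-apex Q large sink distinct cyc)) ,
  (λ source → vortex-free i a c d (source-apex Q large source distinct cyc)) ,
  vortex-free i
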